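{- Let $A$ be a dipole, i.e., a graph with two vertices joined by $d$ parallel normal edges (and no other edges). Then for every graph $B$, $A \triangleright B$ implies $A \longrightarrow B$.
   Context: A graph has finite vertex and edge sets; every edge is a normal edge (two distinct end-vertices, adding 1 to each degree), a loop (one vertex, adding 2 to its degree) or a semi-edge (one vertex, adding 1 to its degree); multiple loops, semi-edges and parallel edges are allowed. A graph is simple if it has no loops, semi-edges or parallel normal edges. A covering projection from $G$ to a connected graph $H$ is a pair of surjective maps $f_V:V(G)\to V(H)$, $f_E:E(G)\to E(H)$ with $f_V$ degree preserving, $f_E$ mapping semi-edges onto semi-edges and loops onto loops (normal edges may go to normal edges, loops or semi-edges), $f_E$ incidence preserving, and $f_E$ a local bijection between the edge-neighborhoods of each vertex and its image (so the preimage of a loop at $u$ is a disjoint union of cycles spanning $f_V^{ -1}(u)$, the preimage of a semi-edge at $u$ consists of semi-edges and normal edges covering each vertex of $f_V^{ -1}(u)$ exactly once, and the preimage of a normal edge $uv$ is a perfect matching between $f_V^{ -1}(u)$ and $f_V^{ -1}(v)$). $G\longrightarrow H$ means such a projection exists. $A \triangleright B$ means every simple graph covering $A$ also covers $B$. -}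

module Defs where

open import Data.Nat using (ℕ; zero; suc; _+_; _*_)
open import Data.Fin using (Fin; zero; suc; _≟_)
open import Data.Product using (Σ; ∃; _×_; _,_)
open import Data.Sum using (_⊎_)
open import Relation.Nullary using (¬_; yes; no)
open import Relation.Binary.PropositionalEquality using (_≡_; _≢_)

data Edge (n : ℕ) : Set where
  normal : (u v : Fin n) → u ≢ v → Edge n
  loop   : Fin n → Edge n                   -- adds 2 to the degree
  semi   : Fin n → Edge n                   -- adds 1 to the degree

record Graph : Set where
  constructor graph
  field
    nV  : ℕ
    nE  : ℕ
    end : Fin nE → Edge nV
open Graph public

Σ[<_]_ : (m : ℕ) → (Fin m → ℕ) → ℕ
Σ[< zero ] f = 0
Σ[< suc m ] f = f zero + Σ[< m ] (λ i → f (suc i))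

eq? : ∀ {n} → Fin n → Fin n → ℕ
eq? x y with x ≟ y
... | yes _ = 1
... | no  _ = 0

incE : ∀ {n} → Edge n → Fin n → ℕ
incE (normal u v _) x = eq? u x + eq? v x
incE (loop u) x = 2 * eq? u x
incE (semi u) x = eq? u x

inc : (G : Graph) → Fin (nE G) → Fin (nV G) → ℕ
inc G e x = incE (end G e) x

deg : (G : Graph) → Fin (nV G) → ℕ
deg G x = Σ[< nE G ] (λ e → inc G e x)

data IsNormal {n : ℕ} : Edge n → Set where
  isNormal : ∀ u v (p : u ≢ v) → IsNormal (normal u v p)

SameEnds : ∀ {n} → Edge n → Edge n → Set
SameEnds (normal u v _) (normal u' v' _) = (u ≡ u' × v ≡ v') ⊎ (u ≡ v' × v ≡ u')
SameEnds _ _ = Data.Empty.⊥ where import Data.Empty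

record Simple (G : Graph) : Set where
  field
    allNormal    : ∀ e → IsNormal (end G e)
    noParallel   : ∀ e e' → SameEnds (end G e) (end G e') → e ≡ e'

data Reach (G : Graph) : Fin (nV G) → Fin (nV G) → Set where
  here : ∀ x → Reach G x x
  step : ∀ {x z} e (p : _) → end G e ≡ normal x z p → ∀ {y} → Reach G z y → Reach G x y
  stepBack : ∀ {x z} e (p : _) → end G e ≡ normal z x p → ∀ {y} → Reach G z y → Reach G x y

Connected : Graph → Set
Connected G = ∀ x y → Reach G x y

Surjective : {A B : Set} → (A → B) → Set
Surjective {A} {B} f = ∀ b → Σ A (λ a → f a ≡ b)

Preserves : ∀ {n n'} → (Fin n → Fin n') → Edge n → Edge n' → Set
Preserves f (normal x y _) (normal u v _) = (f x ≡ u × f y ≡ v) ⊎ (f x ≡ v × f y ≡ u)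
Preserves f (normal x y _) (loop u) = f x ≡ u × f y ≡ u
Preserves f (normal x y _) (semi u) = f x ≡ u × f y ≡ u
Preserves f (loop x) (loop u) = f x ≡ u
Preserves f (semi x) (semi u) = f x ≡ u
Preserves f _ _ = Data.Empty.⊥ where import Data.Empty

record CoveringProjection (G H : Graph) : Set where
  field
    fV : Fin (nV G) → Fin (nV H)
    fE : Fin (nE G) → Fin (nE H)
    fV-surj : Surjective fV
    fE-surj : Surjective fE
    degree-preserving : ∀ x → deg G x ≡ deg H (fV x)
    incidence-preserving : ∀ e → Preserves fV (end G e) (end H (fE e))
    -- local bijection between edge-neighbourhoods (counted with incidence
    -- multiplicity, a loop occupying two places in the neighbourhood):
    -- for every vertex x of G and every edge e' of H, the edges of G over e'
    -- fill the incidences of e' at fV x exactly once.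
    local-bijection : ∀ x e' →
      Σ[< nE G ] (λ e → eq? (fE e) e' * inc G e x) ≡ inc H e' (fV x)

_⟶_ : Graph → Graph → Set
G ⟶ H = Connected H × CoveringProjection G H

_▷_ : Graph → Graph → Set
A ▷ B = ∀ (G : Graph) → Simple G → G ⟶ A → G ⟶ B

0≢1 : _≢_ {A = Fin 2} zero (suc zero)
0≢1 ()

Dipole : ℕ → Graph
Dipole d = graph 2 d (λ _ → normal zero (suc zero) 0≢1)

{-# OPTIONS --safe #-}
-- The bipartite circulants on n + n vertices (left vertex i joined to right vertex i + j mod n by an
-- edge of colour j < d) are simple and cover the dipole for n = d and n = d + 1, so both cover B.
-- Over a connected base all fibres have the same size, so |V(B)| divides 2d and 2d + 2, whence
-- |V(B)| ≤ 2. A lift of a loop or semi-edge at u into a bipartite cover joins the two colour classes,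
-- which therefore split the fibre of u evenly; with |V(B)| = 2 the fibres have sizes d and d + 1, so
-- all edges of B are normal. Thus B is one vertex with loops and semi-edges or two vertices joined by
-- parallel edges, and the dipole covers it by spreading its d edges over the edge-ends at one vertex.
module Submission where

open import Defs
open import Algebra.Properties.CommutativeSemigroup using (interchange)
open import Data.Nat
  using (ℕ; zero; suc; _+_; _*_; _∸_; _%_; _≤_; _<_; z≤n; s≤s; NonZero; >-nonZero; >-nonZero⁻¹)
open import Data.Nat.Properties
  using (+-comm; +-assoc; +-suc; +-identityʳ; *-identityˡ; *-identityʳ; *-zeroʳ; *-assoc;
         *-distribˡ-+; *-distribʳ-+; *-cancelˡ-≡; ≤-refl; ≤-reflexive; <⇒≤; n≤1+n;
         m+[n∸m]≡n; m∸n+n≡m; even≢odd; +-commutativeSemigroup)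
open import Data.Nat.DivMod using (_mod_; %-distribˡ-+; m%n%n≡m%n; [m+n]%n≡m%n; m<n⇒m%n≡m)
open import Data.Nat.Divisibility using (_∣_; m∣m*n; ∣m+n∣m⇒∣n; ∣⇒≤)
open import Data.Fin
  using (Fin; zero; suc; _≟_; toℕ; fromℕ<; inject≤; _↑ˡ_; _↑ʳ_; splitAt; join; combine; remQuot)
open import Data.Fin.Properties
  using (suc-injective; toℕ-injective; toℕ-fromℕ<; toℕ<n; inject≤-injective; ↑ˡ-injective; ↑ʳ-injective;
         splitAt-↑ˡ; splitAt-↑ʳ; join-splitAt; remQuot-combine; combine-remQuot)
open import Data.Product using (∃; _×_; _,_; proj₁; proj₂; uncurry)
open import Data.Sum using (_⊎_; inj₁; inj₂; [_,_]; [_,_]′; map)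
open import Data.Empty using (⊥-elim)
open import Function using (_∘_; id; const)
open import Relation.Nullary using (¬_; yes; no)
open import Relation.Binary.PropositionalEquality
  using (_≡_; _≢_; refl; sym; trans; cong; cong₂; subst; module ≡-Reasoning)

open ≡-Reasoning

eq?-refl : ∀ {n} (a : Fin n) → eq? a a ≡ 1
eq?-refl a with a ≟ a
... | yes _ = refl
... | no a≢a = ⊥-elim (a≢a refl)

eq?-≢ : ∀ {n} {a b : Fin n} → a ≢ b → eq? a b ≡ 0
eq?-≢ {a = a} {b} a≢b with a ≟ b
... | yes a≡b = ⊥-elim (a≢b a≡b)
... | no _ = refl

eq?-sym : ∀ {n} (a b : Fin n) → eq? a b ≡ eq? b a
eq?-sym a b with a ≟ b
... | yes refl = sym (eq?-refl a)
... | no a≢b = sym (eq?-≢ (a≢b ∘ sym))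

eq?-injective : ∀ {m n} {f : Fin m → Fin n} → (∀ {a b} → f a ≡ f b → a ≡ b) →
                ∀ a b → eq? (f a) (f b) ≡ eq? a b
eq?-injective {f = f} f-inj a b with a ≟ b
... | yes refl = eq?-refl (f a)
... | no a≢b = eq?-≢ (a≢b ∘ f-inj)

eq?-inverse : ∀ {n} {f g : Fin n → Fin n} → (∀ a → g (f a) ≡ a) → (∀ b → f (g b) ≡ b) →
              ∀ a b → eq? (f a) b ≡ eq? a (g b)
eq?-inverse {f = f} {g} gf fg a b with a ≟ g b
... | yes refl = trans (cong (λ y → eq? y b) (fg b)) (eq?-refl b)
... | no a≢gb = eq?-≢ (λ fa≡b → a≢gb (trans (sym (gf a)) (cong g fa≡b)))

eq?-* : ∀ {n} {a b : Fin n} {k} → (a ≡ b → k ≡ 1) → eq? a b * k ≡ eq? a b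
eq?-* {a = a} {b} {k} k≡1 with a ≟ b
... | yes a≡b = trans (*-identityˡ k) (k≡1 a≡b)
... | no _ = refl

eq?-subst : ∀ {n} (h : Fin n → ℕ) (a b : Fin n) w → h b * (eq? a b * w) ≡ h a * (eq? a b * w)
eq?-subst h a b w with a ≟ b
... | yes refl = refl
... | no _ = trans (*-zeroʳ (h b)) (sym (*-zeroʳ (h a)))

eq?-0+eq?-1≡1 : ∀ (t : Fin 2) → eq? t zero + eq? t (suc zero) ≡ 1
eq?-0+eq?-1≡1 zero = refl
eq?-0+eq?-1≡1 (suc zero) = refl

Σ-cong : ∀ m {f g : Fin m → ℕ} → (∀ i → f i ≡ g i) → Σ[< m ] f ≡ Σ[< m ] g
Σ-cong zero f≗g = refl
Σ-cong (suc m) f≗g = cong₂ _+_ (f≗g zero) (Σ-cong m (f≗g ∘ suc))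

Σ-zero : ∀ m → Σ[< m ] (λ _ → 0) ≡ 0
Σ-zero zero = refl
Σ-zero (suc m) = Σ-zero m

Σ-const : ∀ m c → Σ[< m ] (λ _ → c) ≡ m * c
Σ-const zero c = refl
Σ-const (suc m) c = cong (c +_) (Σ-const m c)

Σ-+ : ∀ m (f g : Fin m → ℕ) → Σ[< m ] (λ i → f i + g i) ≡ Σ[< m ] f + Σ[< m ] g
Σ-+ zero f g = refl
Σ-+ (suc m) f g = trans (cong (f zero + g zero +_) (Σ-+ m (f ∘ suc) (g ∘ suc)))
                        (interchange +-commutativeSemigroup (f zero) (g zero) _ _)

Σ-*ˡ : ∀ m c (f : Fin m → ℕ) → Σ[< m ] (λ i → c * f i) ≡ c * Σ[< m ] f
Σ-*ˡ zero c f = sym (*-zeroʳ c)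
Σ-*ˡ (suc m) c f = trans (cong (c * f zero +_) (Σ-*ˡ m c (f ∘ suc))) (sym (*-distribˡ-+ c (f zero) _))

Σ-*ʳ : ∀ m c (f : Fin m → ℕ) → Σ[< m ] (λ i → f i * c) ≡ Σ[< m ] f * c
Σ-*ʳ zero c f = refl
Σ-*ʳ (suc m) c f = trans (cong (f zero * c +_) (Σ-*ʳ m c (f ∘ suc))) (sym (*-distribʳ-+ c (f zero) _))

Σ-swap : ∀ m n (f : Fin m → Fin n → ℕ) →
         Σ[< m ] (λ i → Σ[< n ] (f i)) ≡ Σ[< n ] (λ j → Σ[< m ] (λ i → f i j))
Σ-swap zero n f = sym (Σ-zero n)
Σ-swap (suc m) n f = trans (cong (Σ[< n ] (f zero) +_) (Σ-swap m n (f ∘ suc)))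
                           (sym (Σ-+ n (f zero) (λ j → Σ[< m ] (λ i → f (suc i) j))))

Σ-splitAt : ∀ m n (f : Fin (m + n) → ℕ) →
            Σ[< m + n ] f ≡ Σ[< m ] (λ i → f (i ↑ˡ n)) + Σ[< n ] (λ k → f (m ↑ʳ k))
Σ-splitAt zero n f = refl
Σ-splitAt (suc m) n f = trans (cong (f zero +_) (Σ-splitAt m n (f ∘ suc))) (sym (+-assoc (f zero) _ _))

Σ-combine : ∀ m n (f : Fin (m * n) → ℕ) → Σ[< m * n ] f ≡ Σ[< m ] (λ i → Σ[< n ] (λ j → f (combine i j)))
Σ-combine zero n f = refl
Σ-combine (suc m) n f = trans (Σ-splitAt n (m * n) f)
                              (cong (Σ[< n ] (λ j → f (j ↑ˡ (m * n))) +_) (Σ-combine m n (f ∘ (n ↑ʳ_))))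

Σ-eq?ˡ : ∀ m (a : Fin m) (f : Fin m → ℕ) → Σ[< m ] (λ i → eq? a i * f i) ≡ f a
Σ-eq?ˡ (suc m) zero f = trans (cong (f zero + 0 +_) (Σ-zero m)) (trans (+-identityʳ _) (+-identityʳ _))
Σ-eq?ˡ (suc m) (suc a) f = trans (Σ-cong m (λ i → cong (_* f (suc i)) (eq?-injective suc-injective a i)))
                                 (Σ-eq?ˡ m a (f ∘ suc))

Σ-eq?ʳ : ∀ m (a : Fin m) (f : Fin m → ℕ) → Σ[< m ] (λ i → eq? i a * f i) ≡ f a
Σ-eq?ʳ m a f = trans (Σ-cong m (λ i → cong (_* f i) (eq?-sym i a))) (Σ-eq?ˡ m a f)

Σ-eq? : ∀ m (a : Fin m) → Σ[< m ] (λ i → eq? i a) ≡ 1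
Σ-eq? m a = trans (Σ-cong m (λ i → sym (*-identityʳ _))) (Σ-eq?ʳ m a (const 1))

fibre-nonempty : ∀ {n} m (f : Fin m → Fin n) b → 0 < Σ[< m ] (λ i → eq? (f i) b) → ∃ λ i → f i ≡ b
fibre-nonempty zero f b ()
fibre-nonempty (suc m) f b pos with f zero ≟ b
... | yes f0≡b = zero , f0≡b
... | no _ with fibre-nonempty m (f ∘ suc) b pos
...   | i , fi≡b = suc i , fi≡b

dipoleEdge : Edge 2
dipoleEdge = normal zero (suc zero) 0≢1

incE-dipoleEdge : ∀ y → incE dipoleEdge y ≡ 1
incE-dipoleEdge zero = refl
incE-dipoleEdge (suc zero) = refl

incE-normalˡ : ∀ {n} {u v : Fin n} (u≢v : u ≢ v) → incE (normal u v u≢v) u ≡ 1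
incE-normalˡ {u = u} u≢v = cong₂ _+_ (eq?-refl u) (eq?-≢ (u≢v ∘ sym))

incE-normalʳ : ∀ {n} {u v : Fin n} (u≢v : u ≢ v) → incE (normal u v u≢v) v ≡ 1
incE-normalʳ {v = v} u≢v = cong₂ _+_ (eq?-≢ u≢v) (eq?-refl v)

incE-loop-or-semi : ∀ {n} {E : Edge n} {u} → E ≡ loop u ⊎ E ≡ semi u → 0 < incE E u
incE-loop-or-semi {u = u} (inj₁ refl) rewrite eq?-refl u = s≤s z≤n
incE-loop-or-semi {u = u} (inj₂ refl) rewrite eq?-refl u = s≤s z≤n

Σ-incE-normal : ∀ {n} {a b : Fin n} (a≢b : a ≢ b) (W : Fin n → ℕ) →
                Σ[< n ] (λ x → incE (normal a b a≢b) x * W x) ≡ W a + W b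
Σ-incE-normal {n} {a} {b} _ W = begin
  Σ[< n ] (λ x → (eq? a x + eq? b x) * W x)
    ≡⟨ Σ-cong n (λ x → *-distribʳ-+ (W x) (eq? a x) (eq? b x)) ⟩
  Σ[< n ] (λ x → eq? a x * W x + eq? b x * W x)
    ≡⟨ Σ-+ n _ _ ⟩
  Σ[< n ] (λ x → eq? a x * W x) + Σ[< n ] (λ x → eq? b x * W x)
    ≡⟨ cong₂ _+_ (Σ-eq?ˡ n a W) (Σ-eq?ˡ n b W) ⟩
  W a + W b ∎

preserves-normal-ends : ∀ {n n'} (f : Fin n → Fin n') {a b u v} →
                        (f a ≡ u × f b ≡ v) ⊎ (f a ≡ v × f b ≡ u) →
                        (V : Fin n' → ℕ) → V (f a) + V (f b) ≡ V u + V v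
preserves-normal-ends f (inj₁ (refl , refl)) V = refl
preserves-normal-ends f {a} {b} (inj₂ (refl , refl)) V = +-comm (V (f a)) (V (f b))

Σ-incE-over-normal : ∀ {n n'} {f : Fin n → Fin n'} E {u v u≢v} → Preserves f E (normal u v u≢v) →
                     (V : Fin n' → ℕ) → Σ[< n ] (λ x → incE E x * V (f x)) ≡ V u + V v
Σ-incE-over-normal {f = f} (normal a b a≢b) ends V =
  trans (Σ-incE-normal a≢b (V ∘ f)) (preserves-normal-ends f ends V)

Σ-incE-crossing : ∀ {n n'} {f : Fin n → Fin n'} {side : Fin n → Fin 2} E {u} →
                  Preserves side E dipoleEdge → Preserves f E (loop u) ⊎ Preserves f E (semi u) →
                  ∀ s → Σ[< n ] (λ x → incE E x * (eq? (f x) u * eq? (side x) s)) ≡ 1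
Σ-incE-crossing {f = f} {side} (normal a b a≢b) {u} crossing over-u s = begin
  Σ[< _ ] (λ x → incE (normal a b a≢b) x * (eq? (f x) u * eq? (side x) s))
    ≡⟨ Σ-incE-normal a≢b _ ⟩
  eq? (f a) u * eq? (side a) s + eq? (f b) u * eq? (side b) s
    ≡⟨ cong₂ _+_ (at-u fa≡u) (at-u fb≡u) ⟩
  eq? (side a) s + eq? (side b) s
    ≡⟨ preserves-normal-ends side crossing (λ t → eq? t s) ⟩
  incE dipoleEdge s
    ≡⟨ incE-dipoleEdge s ⟩
  1 ∎
  where
  fa≡u : f a ≡ u
  fa≡u = proj₁ ([ id , id ]′ over-u)
  fb≡u : f b ≡ u
  fb≡u = proj₂ ([ id , id ]′ over-u)
  at-u : ∀ {y k} → f y ≡ u → eq? (f y) u * k ≡ k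
  at-u {k = k} refl = trans (cong (_* k) (eq?-refl (f _))) (*-identityˡ k)

-- Degrees and fibres of covering projections

deg-Dipole : ∀ d y → deg (Dipole d) y ≡ d
deg-Dipole d y = trans (Σ-cong d (λ _ → incE-dipoleEdge y)) (trans (Σ-const d 1) (*-identityʳ d))

dipole-connected : ∀ d → Connected (Dipole (suc d))
dipole-connected d zero zero = here zero
dipole-connected d zero (suc zero) = step zero 0≢1 refl (here (suc zero))
dipole-connected d (suc zero) zero = stepBack zero 0≢1 refl (here zero)
dipole-connected d (suc zero) (suc zero) = here (suc zero)

local-bijection⇒deg≡ : ∀ G H (fE : Fin (nE G) → Fin (nE H)) x y →
                       (∀ c → Σ[< nE G ] (λ e → eq? (fE e) c * inc G e x) ≡ inc H c y) → deg G x ≡ deg H y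
local-bijection⇒deg≡ G H fE x y bijection = begin
  Σ[< nE G ] (λ e → inc G e x)
    ≡⟨ Σ-cong (nE G) (λ e → sym (Σ-eq?ˡ (nE H) (fE e) (const (inc G e x)))) ⟩
  Σ[< nE G ] (λ e → Σ[< nE H ] (λ c → eq? (fE e) c * inc G e x))
    ≡⟨ Σ-swap (nE G) (nE H) _ ⟩
  Σ[< nE H ] (λ c → Σ[< nE G ] (λ e → eq? (fE e) c * inc G e x))
    ≡⟨ Σ-cong (nE H) bijection ⟩
  Σ[< nE H ] (λ c → inc H c y) ∎

covering-regular : ∀ {G H B d} → CoveringProjection G B → CoveringProjection G H →
                   (∀ y → deg H y ≡ d) → ∀ u → deg B u ≡ d
covering-regular {G} {H} {B} {d} C π H-regular u = begin
  deg B u        ≡⟨ cong (deg B) (sym (proj₂ (fV-surj C u))) ⟩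
  deg B (fV C x) ≡⟨ sym (degree-preserving C x) ⟩
  deg G x        ≡⟨ degree-preserving π x ⟩
  deg H (fV π x) ≡⟨ H-regular (fV π x) ⟩
  d              ∎
  where
  open CoveringProjection
  x = proj₁ (fV-surj C u)

module Fibres {G B : Graph} (C : CoveringProjection G B) where
  open CoveringProjection C

  fibreWeight : (Fin (nV G) → ℕ) → Fin (nV B) → ℕ
  fibreWeight W u = Σ[< nV G ] (λ x → eq? (fV x) u * W x)

  fibreSize : Fin (nV B) → ℕ
  fibreSize = fibreWeight (const 1)

  edgeFibreSize : Fin (nE B) → ℕ
  edgeFibreSize e' = Σ[< nE G ] (λ e → eq? (fE e) e')

  lift-preserves : ∀ {e e' E'} → fE e ≡ e' → end B e' ≡ E' → Preserves fV (end G e) E'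
  lift-preserves {e} fe≡e' end≡E' =
    subst (Preserves fV (end G e)) (trans (cong (end B) fe≡e') end≡E') (incidence-preserving e)

  Σ-inc-lift : ∀ (W : Fin (nV G) → ℕ) e' →
               Σ[< nV G ] (λ x → inc B e' (fV x) * W x)
               ≡ Σ[< nE G ] (λ e → eq? (fE e) e' * Σ[< nV G ] (λ x → inc G e x * W x))
  Σ-inc-lift W e' = begin
    Σ[< nV G ] (λ x → inc B e' (fV x) * W x)
      ≡⟨ Σ-cong (nV G) (λ x → cong (_* W x) (sym (local-bijection x e'))) ⟩
    Σ[< nV G ] (λ x → Σ[< nE G ] (λ e → eq? (fE e) e' * inc G e x) * W x)
      ≡⟨ Σ-cong (nV G) (λ x → sym (Σ-*ʳ (nE G) (W x) _)) ⟩
    Σ[< nV G ] (λ x → Σ[< nE G ] (λ e → eq? (fE e) e' * inc G e x * W x))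
      ≡⟨ Σ-swap (nV G) (nE G) _ ⟩
    Σ[< nE G ] (λ e → Σ[< nV G ] (λ x → eq? (fE e) e' * inc G e x * W x))
      ≡⟨ Σ-cong (nE G) (λ e → trans (Σ-cong (nV G) (λ x → *-assoc (eq? (fE e) e') (inc G e x) (W x)))
                                     (Σ-*ˡ (nV G) (eq? (fE e) e') (λ x → inc G e x * W x))) ⟩
    Σ[< nE G ] (λ e → eq? (fE e) e' * Σ[< nV G ] (λ x → inc G e x * W x)) ∎

  fibreWeight-count : ∀ W u e' →
                      (∀ e → fE e ≡ e' → Σ[< nV G ] (λ x → inc G e x * (eq? (fV x) u * W x)) ≡ 1) →
                      inc B e' u * fibreWeight W u ≡ edgeFibreSize e'
  fibreWeight-count W u e' one-incidence = begin
    inc B e' u * fibreWeight W u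
      ≡⟨ sym (Σ-*ˡ (nV G) (inc B e' u) _) ⟩
    Σ[< nV G ] (λ x → inc B e' u * (eq? (fV x) u * W x))
      ≡⟨ Σ-cong (nV G) (λ x → eq?-subst (inc B e') (fV x) u (W x)) ⟩
    Σ[< nV G ] (λ x → inc B e' (fV x) * (eq? (fV x) u * W x))
      ≡⟨ Σ-inc-lift _ e' ⟩
    Σ[< nE G ] (λ e → eq? (fE e) e' * Σ[< nV G ] (λ x → inc G e x * (eq? (fV x) u * W x)))
      ≡⟨ Σ-cong (nE G) (λ e → eq?-* (one-incidence e)) ⟩
    edgeFibreSize e' ∎

  fibreSize-normal : ∀ e' {u v} (u≢v : u ≢ v) → end B e' ≡ normal u v u≢v →
                     fibreSize u ≡ edgeFibreSize e' × fibreSize v ≡ edgeFibreSize e'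
  fibreSize-normal e' {u} {v} u≢v end≡uv = at-end u (incE-normalˡ u≢v) , at-end v (incE-normalʳ u≢v)
    where
    at-end : ∀ w → incE (normal u v u≢v) w ≡ 1 → fibreSize w ≡ edgeFibreSize e'
    at-end w inc≡1 = begin
      fibreSize w                 ≡⟨ sym (*-identityˡ _) ⟩
      1 * fibreSize w             ≡⟨ cong (_* fibreSize w) (sym (trans (cong (λ E → incE E w) end≡uv)
                                                                       inc≡1)) ⟩
      inc B e' w * fibreSize w    ≡⟨ fibreWeight-count (const 1) w e' lifts ⟩
      edgeFibreSize e'            ∎
      where
      lifts : ∀ e → fE e ≡ e' → Σ[< nV G ] (λ x → inc G e x * (eq? (fV x) w * 1)) ≡ 1
      lifts e fe≡e' = trans (Σ-incE-over-normal (end G e) (lift-preserves fe≡e' end≡uv) (λ y → eq? y w * 1))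
                            (trans (cong₂ _+_ (*-identityʳ (eq? u w)) (*-identityʳ (eq? v w))) inc≡1)

  fibreSize-across : ∀ e' {u v} (u≢v : u ≢ v) → end B e' ≡ normal u v u≢v → fibreSize u ≡ fibreSize v
  fibreSize-across e' u≢v end≡uv with fibreSize-normal e' u≢v end≡uv
  ... | Fu≡N , Fv≡N = trans Fu≡N (sym Fv≡N)

  fibreSize-reach : ∀ {u v} → Reach B u v → fibreSize u ≡ fibreSize v
  fibreSize-reach (here _) = refl
  fibreSize-reach (step e' u≢v end≡uv r) = trans (fibreSize-across e' u≢v end≡uv) (fibreSize-reach r)
  fibreSize-reach (stepBack e' v≢u end≡vu r) = trans (sym (fibreSize-across e' v≢u end≡vu)) (fibreSize-reach r)

  Σ-fibreSize : Σ[< nV B ] fibreSize ≡ nV G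
  Σ-fibreSize = begin
    Σ[< nV B ] (λ u → Σ[< nV G ] (λ x → eq? (fV x) u * 1))
      ≡⟨ Σ-swap (nV B) (nV G) _ ⟩
    Σ[< nV G ] (λ x → Σ[< nV B ] (λ u → eq? (fV x) u * 1))
      ≡⟨ Σ-cong (nV G) (λ x → Σ-eq?ˡ (nV B) (fV x) (const 1)) ⟩
    Σ[< nV G ] (λ _ → 1)
      ≡⟨ Σ-const (nV G) 1 ⟩
    nV G * 1
      ≡⟨ *-identityʳ (nV G) ⟩
    nV G ∎

  fibreSize-connected : Connected B → ∀ u → nV B * fibreSize u ≡ nV G
  fibreSize-connected connected u = begin
    nV B * fibreSize u               ≡⟨ sym (Σ-const (nV B) (fibreSize u)) ⟩
    Σ[< nV B ] (λ _ → fibreSize u)   ≡⟨ Σ-cong (nV B) (fibreSize-reach ∘ connected u) ⟩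
    Σ[< nV B ] fibreSize             ≡⟨ Σ-fibreSize ⟩
    nV G                             ∎

  fibreSize-even : ∀ {d} → CoveringProjection G (Dipole d) →
                   ∀ e' u → end B e' ≡ loop u ⊎ end B e' ≡ semi u → ∃ λ k → fibreSize u ≡ 2 * k
  fibreSize-even π e' u loop-or-semi = half zero , (begin
    fibreSize u
      ≡⟨ Σ-cong (nV G) (λ x → cong (eq? (fV x) u *_) (sym (eq?-0+eq?-1≡1 (side x)))) ⟩
    fibreWeight (λ x → eq? (side x) zero + eq? (side x) (suc zero)) u
      ≡⟨ Σ-cong (nV G) (λ x → *-distribˡ-+ (eq? (fV x) u) _ _) ⟩
    Σ[< nV G ] (λ x → eq? (fV x) u * eq? (side x) zero + eq? (fV x) u * eq? (side x) (suc zero))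
      ≡⟨ Σ-+ (nV G) _ _ ⟩
    half zero + half (suc zero)
      ≡⟨ cong (half zero +_) (trans (sym balanced) (sym (+-identityʳ _))) ⟩
    2 * half zero ∎)
    where
    side : Fin (nV G) → Fin 2
    side = CoveringProjection.fV π
    half : Fin 2 → ℕ
    half s = fibreWeight (λ x → eq? (side x) s) u
    count : ∀ s → inc B e' u * half s ≡ edgeFibreSize e'
    count s = fibreWeight-count _ u e' λ e fe≡e' →
      Σ-incE-crossing (end G e) (CoveringProjection.incidence-preserving π e)
        (map (lift-preserves fe≡e') (lift-preserves fe≡e') loop-or-semi) s
    balanced : half zero ≡ half (suc zero)
    balanced = *-cancelˡ-≡ _ _ (inc B e' u) {{>-nonZero (incE-loop-or-semi loop-or-semi)}}
                 (trans (count zero) (sym (count (suc zero))))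

open Fibres

-- Bipartite circulant covers of the dipole

module _ {n : ℕ} .{{_ : NonZero n}} where

  infixl 6 _⊕_ _⊖_

  _⊕_ : Fin n → Fin n → Fin n
  i ⊕ j = (toℕ i + toℕ j) mod n

  _⊖_ : Fin n → Fin n → Fin n
  i ⊖ j = (toℕ i + (n ∸ toℕ j)) mod n

  ⊕-comm : ∀ i j → i ⊕ j ≡ j ⊕ i
  ⊕-comm i j = cong (_mod n) (+-comm (toℕ i) (toℕ j))

  private
    shift-back : ∀ (i : Fin n) b c → b + c ≡ n → (toℕ ((toℕ i + b) mod n) + c) mod n ≡ i
    shift-back i b c b+c≡n = toℕ-injective (begin
      toℕ ((toℕ ((toℕ i + b) mod n) + c) mod n) ≡⟨ toℕ-fromℕ< _ ⟩
      (toℕ ((toℕ i + b) mod n) + c) % n         ≡⟨ cong (λ r → (r + c) % n) (toℕ-fromℕ< _) ⟩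
      ((toℕ i + b) % n + c) % n                 ≡⟨ %-distribˡ-+ ((toℕ i + b) % n) c n ⟩
      ((toℕ i + b) % n % n + c % n) % n         ≡⟨ cong (λ r → (r + c % n) % n) (m%n%n≡m%n _ n) ⟩
      ((toℕ i + b) % n + c % n) % n             ≡⟨ sym (%-distribˡ-+ (toℕ i + b) c n) ⟩
      (toℕ i + b + c) % n                       ≡⟨ cong (_% n) (trans (+-assoc (toℕ i) b c)
                                                                      (cong (toℕ i +_) b+c≡n)) ⟩
      (toℕ i + n) % n                           ≡⟨ [m+n]%n≡m%n (toℕ i) n ⟩
      toℕ i % n                                 ≡⟨ m<n⇒m%n≡m (toℕ<n i) ⟩
      toℕ i                                     ∎)

  ⊕-⊖ : ∀ i j → i ⊕ j ⊖ j ≡ i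
  ⊕-⊖ i j = shift-back i (toℕ j) (n ∸ toℕ j) (m+[n∸m]≡n (<⇒≤ (toℕ<n j)))

  ⊖-⊕ : ∀ i j → i ⊖ j ⊕ j ≡ i
  ⊖-⊕ i j = shift-back i (n ∸ toℕ j) (toℕ j) (m∸n+n≡m (<⇒≤ (toℕ<n j)))

  ⊕-cancelˡ : ∀ i {j k} → i ⊕ j ≡ i ⊕ k → j ≡ k
  ⊕-cancelˡ i {j} {k} i⊕j≡i⊕k = begin
    j         ≡⟨ sym (⊕-⊖ j i) ⟩
    j ⊕ i ⊖ i ≡⟨ cong (_⊖ i) (trans (⊕-comm j i) (trans i⊕j≡i⊕k (⊕-comm i k))) ⟩
    k ⊕ i ⊖ i ≡⟨ ⊕-⊖ k i ⟩
    k         ∎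

↑ˡ≢↑ʳ : ∀ {m n} (i : Fin m) (k : Fin n) → i ↑ˡ n ≢ m ↑ʳ k
↑ˡ≢↑ʳ {m} {n} i k i↑ˡn≡m↑ʳk
  with trans (sym (splitAt-↑ˡ m i n)) (trans (cong (splitAt m) i↑ˡn≡m↑ʳk) (splitAt-↑ʳ m n k))
... | ()

↑-elim : ∀ {m n} (P : Fin (m + n) → Set) → (∀ i → P (i ↑ˡ n)) → (∀ k → P (m ↑ʳ k)) → ∀ x → P x
↑-elim {m} {n} P left right x = subst P (join-splitAt m n x) ([_,_] {C = P ∘ join m n} left right (splitAt m x))

remQuot-injective : ∀ {m} n (e e' : Fin (m * n)) → remQuot {m} n e ≡ remQuot n e' → e ≡ e'
remQuot-injective {m} n e e' eq =
  trans (sym (combine-remQuot {m} n e)) (trans (cong (uncurry combine) eq) (combine-remQuot {m} n e'))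

module _ (n d : ℕ) .{{_ : NonZero n}} (d≤n : d ≤ n) where

  circulantEdge : Fin n → Fin d → Edge (n + n)
  circulantEdge i j = normal (i ↑ˡ n) (n ↑ʳ (i ⊕ inject≤ j d≤n)) (↑ˡ≢↑ʳ i _)

  Circulant : Graph
  Circulant = graph (n + n) (n * d) (uncurry circulantEdge ∘ remQuot {n} d)

  circulant-simple : Simple Circulant
  circulant-simple = record
    { allNormal = λ _ → isNormal _ _ _
    ; noParallel = λ e e' parallel → remQuot-injective d e e' (circulantEdge-injective parallel)
    }
    where
    circulantEdge-injective : ∀ {i j i' j'} → SameEnds (circulantEdge i j) (circulantEdge i' j') →
                              (i , j) ≡ (i' , j')
    circulantEdge-injective {i} (inj₁ (left , right)) with ↑ˡ-injective n _ _ left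
    ... | refl = cong (i ,_) (inject≤-injective d≤n d≤n _ _ (⊕-cancelˡ i (↑ʳ-injective n _ _ right)))
    circulantEdge-injective (inj₂ (left , _)) = ⊥-elim (↑ˡ≢↑ʳ _ _ left)

  side : Fin (n + n) → Fin 2
  side x = [ const zero , const (suc zero) ]′ (splitAt n x)

  side-↑ˡ : ∀ i → side (i ↑ˡ n) ≡ zero
  side-↑ˡ i = cong [ const zero , const (suc zero) ]′ (splitAt-↑ˡ n i n)

  side-↑ʳ : ∀ k → side (n ↑ʳ k) ≡ suc zero
  side-↑ʳ k = cong [ const zero , const (suc zero) ]′ (splitAt-↑ʳ n n k)

  colour-class-matching : ∀ c x → Σ[< n ] (λ i → incE (circulantEdge i c) x) ≡ 1
  colour-class-matching c = ↑-elim _ at-left at-right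
    where
    c′ : Fin n
    c′ = inject≤ c d≤n
    at-left : ∀ i₀ → Σ[< n ] (λ i → incE (circulantEdge i c) (i₀ ↑ˡ n)) ≡ 1
    at-left i₀ = trans (Σ-cong n (λ i → trans (cong₂ _+_ (eq?-injective (↑ˡ-injective n _ _) i i₀)
                                                         (eq?-≢ (↑ˡ≢↑ʳ i₀ _ ∘ sym)))
                                              (+-identityʳ (eq? i i₀))))
                       (Σ-eq? n i₀)
    at-right : ∀ k → Σ[< n ] (λ i → incE (circulantEdge i c) (n ↑ʳ k)) ≡ 1
    at-right k = trans (Σ-cong n (λ i → cong₂ _+_ (eq?-≢ (↑ˡ≢↑ʳ i k))
                                                  (trans (eq?-injective (↑ʳ-injective n _ _) (i ⊕ c′) k)
                                                         (eq?-inverse {f = _⊕ c′} {_⊖ c′}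
                                                                      (λ i → ⊕-⊖ i c′) (λ i → ⊖-⊕ i c′) i k))))
                       (Σ-eq? n _)

  circulant-covers : CoveringProjection Circulant (Dipole d)
  circulant-covers = record
    { fV = side
    ; fE = colour
    ; fV-surj = λ { zero → origin ↑ˡ n , side-↑ˡ origin ; (suc zero) → n ↑ʳ origin , side-↑ʳ origin }
    ; fE-surj = λ c → combine origin c , cong proj₂ (remQuot-combine {n} origin c)
    ; degree-preserving = λ x → local-bijection⇒deg≡ Circulant (Dipole d) colour x (side x) (bijection x)
    ; incidence-preserving = λ e → inj₁ (side-↑ˡ _ , side-↑ʳ _)
    ; local-bijection = bijection
    }
    where
    origin : Fin n
    origin = fromℕ< (>-nonZero⁻¹ n)
    colour : Fin (n * d) → Fin d
    colour = proj₂ ∘ remQuot {n} d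
    bijection : ∀ x c → Σ[< n * d ] (λ e → eq? (colour e) c * inc Circulant e x)
                        ≡ incE dipoleEdge (side x)
    bijection x c = begin
      Σ[< n * d ] (λ e → coloured (remQuot {n} d e))
        ≡⟨ Σ-combine n d (coloured ∘ remQuot {n} d) ⟩
      Σ[< n ] (λ i → Σ[< d ] (λ j → coloured (remQuot {n} d (combine i j))))
        ≡⟨ Σ-cong n (λ i → Σ-cong d (λ j → cong coloured (remQuot-combine {n} i j))) ⟩
      Σ[< n ] (λ i → Σ[< d ] (λ j → eq? j c * incE (circulantEdge i j) x))
        ≡⟨ Σ-cong n (λ i → Σ-eq?ʳ d c (λ j → incE (circulantEdge i j) x)) ⟩
      Σ[< n ] (λ i → incE (circulantEdge i c) x)
        ≡⟨ colour-class-matching c x ⟩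
      1
        ≡⟨ sym (incE-dipoleEdge (side x)) ⟩
      incE dipoleEdge (side x) ∎
      where
      coloured : Fin n × Fin d → ℕ
      coloured (i , j) = eq? j c * incE (circulantEdge i j) x

-- Coverings by the dipole of graphs on at most two vertices

enumerate : ∀ m (c : Fin m → ℕ) → Fin (Σ[< m ] c) → Fin m
enumerate (suc m) c k = [ const zero , suc ∘ enumerate m (c ∘ suc) ]′ (splitAt (c zero) k)

enumerate-fibre : ∀ m (c : Fin m → ℕ) i → Σ[< Σ[< m ] c ] (λ k → eq? (enumerate m c k) i) ≡ c i
enumerate-fibre (suc m) c i = begin
  Σ[< c zero + rest ] (λ k → eq? (enumerate (suc m) c k) i)
    ≡⟨ Σ-splitAt (c zero) rest _ ⟩
  Σ[< c zero ] (λ k → eq? (enumerate (suc m) c (k ↑ˡ rest)) i)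
    + Σ[< rest ] (λ r → eq? (enumerate (suc m) c (c zero ↑ʳ r)) i)
    ≡⟨ cong₂ _+_ (Σ-cong (c zero) (λ k → cong (λ y → eq? y i) (enumerate-↑ˡ k)))
                 (Σ-cong rest (λ r → cong (λ y → eq? y i) (enumerate-↑ʳ r))) ⟩
  Σ[< c zero ] (λ _ → eq? zero i) + Σ[< rest ] (λ r → eq? (suc (enumerate m (c ∘ suc) r)) i)
    ≡⟨ by-cases i ⟩
  c i ∎
  where
  rest : ℕ
  rest = Σ[< m ] (c ∘ suc)
  enumerate-↑ˡ : ∀ k → enumerate (suc m) c (k ↑ˡ rest) ≡ zero
  enumerate-↑ˡ k = cong [ const zero , suc ∘ enumerate m (c ∘ suc) ]′ (splitAt-↑ˡ (c zero) k rest)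
  enumerate-↑ʳ : ∀ r → enumerate (suc m) c (c zero ↑ʳ r) ≡ suc (enumerate m (c ∘ suc) r)
  enumerate-↑ʳ r = cong [ const zero , suc ∘ enumerate m (c ∘ suc) ]′ (splitAt-↑ʳ (c zero) rest r)
  by-cases : ∀ i → Σ[< c zero ] (λ _ → eq? zero i) + Σ[< rest ] (λ r → eq? (suc (enumerate m (c ∘ suc) r)) i)
                   ≡ c i
  by-cases zero = trans (cong₂ _+_ (trans (Σ-const (c zero) 1) (*-identityʳ (c zero))) (Σ-zero rest))
                        (+-identityʳ (c zero))
  by-cases (suc i) = cong₂ _+_ (Σ-zero (c zero))
                       (trans (Σ-cong rest (λ r → eq?-injective suc-injective (enumerate m (c ∘ suc) r) i))
                              (enumerate-fibre m (c ∘ suc) i))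

preserves-dipoleEdge-incE : ∀ {n} (f : Fin 2 → Fin n) E → Preserves f dipoleEdge E →
                            incE E (f zero) ≡ incE E (f (suc zero)) × 0 < incE E (f zero)
preserves-dipoleEdge-incE f (normal _ _ u≢v) (inj₁ (refl , refl)) =
  trans (incE-normalˡ u≢v) (sym (incE-normalʳ u≢v)) , ≤-reflexive (sym (incE-normalˡ u≢v))
preserves-dipoleEdge-incE f (normal _ _ u≢v) (inj₂ (refl , refl)) =
  trans (incE-normalʳ u≢v) (sym (incE-normalˡ u≢v)) , ≤-reflexive (sym (incE-normalʳ u≢v))
preserves-dipoleEdge-incE f (loop _) (refl , f1≡u) =
  cong (incE (loop (f zero))) (sym f1≡u) , incE-loop-or-semi {E = loop (f zero)} (inj₁ refl)
preserves-dipoleEdge-incE f (semi _) (refl , f1≡u) =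
  cong (incE (semi (f zero))) (sym f1≡u) , incE-loop-or-semi {E = semi (f zero)} (inj₂ refl)

dipole-covers : ∀ B → Connected B → (fV : Fin 2 → Fin (nV B)) → Surjective fV →
                (∀ e' → Preserves fV dipoleEdge (end B e')) → Dipole (deg B (fV zero)) ⟶ B
dipole-covers B connected fV fV-surj ends = connected , record
  { fV = fV
  ; fE = fE
  ; fV-surj = fV-surj
  ; fE-surj = λ e' → fibre-nonempty D fE e' (subst (0 <_) (sym (enumerate-fibre (nE B) multiplicity e'))
                                                           (proj₂ (incidences e')))
  ; degree-preserving = λ x → local-bijection⇒deg≡ (Dipole D) B fE x (fV x) (bijection x)
  ; incidence-preserving = ends ∘ fE
  ; local-bijection = bijection
  }
  where
  D : ℕ
  D = deg B (fV zero)
  multiplicity : Fin (nE B) → ℕ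
  multiplicity e' = inc B e' (fV zero)
  fE : Fin D → Fin (nE B)
  fE = enumerate (nE B) multiplicity
  incidences : ∀ e' → multiplicity e' ≡ inc B e' (fV (suc zero)) × 0 < multiplicity e'
  incidences e' = preserves-dipoleEdge-incE fV (end B e') (ends e')
  balanced : ∀ e' x → inc B e' (fV x) ≡ multiplicity e'
  balanced e' zero = refl
  balanced e' (suc zero) = sym (proj₁ (incidences e'))
  bijection : ∀ x e' → Σ[< D ] (λ k → eq? (fE k) e' * incE dipoleEdge x) ≡ inc B e' (fV x)
  bijection x e' = begin
    Σ[< D ] (λ k → eq? (fE k) e' * incE dipoleEdge x)
      ≡⟨ Σ-cong D (λ k → trans (cong (eq? (fE k) e' *_) (incE-dipoleEdge x)) (*-identityʳ _)) ⟩
    Σ[< D ] (λ k → eq? (fE k) e')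
      ≡⟨ enumerate-fibre (nE B) multiplicity e' ⟩
    multiplicity e'
      ≡⟨ sym (balanced e' x) ⟩
    inc B e' (fV x) ∎

const-preserves-dipoleEdge : ∀ (E : Edge 1) → Preserves (const zero) dipoleEdge E
const-preserves-dipoleEdge (normal zero zero 0≢0) = ⊥-elim (0≢0 refl)
const-preserves-dipoleEdge (loop zero) = refl , refl
const-preserves-dipoleEdge (semi zero) = refl , refl

id-preserves-dipoleEdge : ∀ (E : Edge 2) → IsNormal E → Preserves id dipoleEdge E
id-preserves-dipoleEdge _ (isNormal zero zero 0≢0) = ⊥-elim (0≢0 refl)
id-preserves-dipoleEdge _ (isNormal zero (suc zero) _) = inj₁ (refl , refl)
id-preserves-dipoleEdge _ (isNormal (suc zero) zero _) = inj₂ (refl , refl)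
id-preserves-dipoleEdge _ (isNormal (suc zero) (suc zero) 1≢1) = ⊥-elim (1≢1 refl)

dipole-covers-order≤2 : ∀ {d} B → Connected B → (∀ u → deg B u ≡ d) → Fin (nV B) → nV B ≤ 2 →
                        (nV B ≡ 2 → ∀ e' → IsNormal (end B e')) → Dipole d ⟶ B
dipole-covers-order≤2 (graph 0 _ _) _ _ () _ _
dipole-covers-order≤2 B@(graph 1 _ end) connected regular _ _ _ =
  subst (λ k → Dipole k ⟶ B) (regular zero)
        (dipole-covers B connected (const zero) (λ { zero → zero , refl }) (const-preserves-dipoleEdge ∘ end))
dipole-covers-order≤2 B@(graph 2 _ end) connected regular _ _ only-normal =
  subst (λ k → Dipole k ⟶ B) (regular zero)
        (dipole-covers B connected id (λ u → u , refl) λ e' → id-preserves-dipoleEdge (end e') (only-normal refl e'))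
dipole-covers-order≤2 (graph (suc (suc (suc _))) _ _) _ _ _ (s≤s (s≤s ())) _

-- Graphs covered by both circulants

m∣n+n⇒m∣[1+n]+[1+n]⇒m≤2 : ∀ {m n} → m ∣ n + n → m ∣ suc n + suc n → m ≤ 2
m∣n+n⇒m∣[1+n]+[1+n]⇒m≤2 {m} {n} m∣2n m∣2n+2 =
  ∣⇒≤ (∣m+n∣m⇒∣n (subst (m ∣_) (trans (cong suc (+-suc n n)) (+-comm 2 (n + n))) m∣2n+2) m∣2n)

2*m≡n+n⇒m≡n : ∀ {m n} → 2 * m ≡ n + n → m ≡ n
2*m≡n+n⇒m≡n {m} {n} eq = *-cancelˡ-≡ m n 2 (trans eq (cong (n +_) (sym (+-identityʳ n))))

no-loop-or-semi : ∀ {G₁ G₂ B d₁ d₂} (C₁ : CoveringProjection G₁ B) (C₂ : CoveringProjection G₂ B) →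
                  CoveringProjection G₁ (Dipole d₁) → CoveringProjection G₂ (Dipole d₂) →
                  (∀ u → fibreSize C₂ u ≡ suc (fibreSize C₁ u)) →
                  ∀ e' u → ¬ (end B e' ≡ loop u ⊎ end B e' ≡ semi u)
no-loop-or-semi C₁ C₂ π₁ π₂ differ e' u loop-or-semi
  with fibreSize-even C₁ π₁ e' u loop-or-semi | fibreSize-even C₂ π₂ e' u loop-or-semi
... | k₁ , F₁≡2k₁ | k₂ , F₂≡2k₂ = even≢odd k₂ k₁ (begin
  2 * k₂               ≡⟨ sym F₂≡2k₂ ⟩
  fibreSize C₂ u       ≡⟨ differ u ⟩
  suc (fibreSize C₁ u) ≡⟨ cong suc F₁≡2k₁ ⟩
  suc (2 * k₁)         ∎)

only-normal-edges : ∀ {G₁ G₂ B d₁ d₂} (C₁ : CoveringProjection G₁ B) (C₂ : CoveringProjection G₂ B) →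
                    CoveringProjection G₁ (Dipole d₁) → CoveringProjection G₂ (Dipole d₂) →
                    (∀ u → fibreSize C₂ u ≡ suc (fibreSize C₁ u)) → ∀ e' → IsNormal (end B e')
only-normal-edges {B = B} C₁ C₂ π₁ π₂ differ e' with end B e' in end≡
... | normal u v u≢v = isNormal u v u≢v
... | loop u = ⊥-elim (no-loop-or-semi C₁ C₂ π₁ π₂ differ e' u (inj₁ end≡))
... | semi u = ⊥-elim (no-loop-or-semi C₁ C₂ π₁ π₂ differ e' u (inj₂ end≡))

theorem3 : (d : ℕ) → 1 ≤ d → (B : Graph) → Dipole d ▷ B → Dipole d ⟶ B
theorem3 d@(suc d') _ B Dipole▷B = dipole-covers-order≤2 B connected regular u₀ order≤2 two⇒only-normal
  where
  covered : ∀ n .{{_ : NonZero n}} (d≤n : d ≤ n) → Circulant n d d≤n ⟶ B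
  covered n d≤n = Dipole▷B _ (circulant-simple n d d≤n) (dipole-connected d' , circulant-covers n d d≤n)
  connected : Connected B
  connected = proj₁ (covered d ≤-refl)
  C₁ : CoveringProjection (Circulant d d ≤-refl) B
  C₁ = proj₂ (covered d ≤-refl)
  C₂ : CoveringProjection (Circulant (suc d) d (n≤1+n d)) B
  C₂ = proj₂ (covered (suc d) (n≤1+n d))
  u₀ : Fin (nV B)
  u₀ = CoveringProjection.fV C₁ (zero ↑ˡ d)
  regular : ∀ u → deg B u ≡ d
  regular = covering-regular C₁ (circulant-covers d d ≤-refl) (deg-Dipole d)
  order≤2 : nV B ≤ 2
  order≤2 = m∣n+n⇒m∣[1+n]+[1+n]⇒m≤2 {n = d}
              (subst (nV B ∣_) (fibreSize-connected C₁ connected u₀) (m∣m*n _))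
              (subst (nV B ∣_) (fibreSize-connected C₂ connected u₀) (m∣m*n _))
  two⇒only-normal : nV B ≡ 2 → ∀ e' → IsNormal (end B e')
  two⇒only-normal two =
    only-normal-edges C₁ C₂ (circulant-covers d d ≤-refl) (circulant-covers (suc d) d (n≤1+n d)) λ u →
      trans (2*m≡n+n⇒m≡n {n = suc d} (doubled C₂ u)) (cong suc (sym (2*m≡n+n⇒m≡n {n = d} (doubled C₁ u))))
    where
    doubled : ∀ {G} (C : CoveringProjection G B) u → 2 * fibreSize C u ≡ nV G
    doubled C u = subst (λ o → o * fibreSize C u ≡ _) two (fibreSize-connected C connected u)
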